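{- For $N\in\mathbb{N}$, \begin{equation*} \sum_{n=1}^{N}\left[\begin{matrix} N \\ n\end{matrix}\right] \frac{(q)_n (zc)^n q^{n^2}}{(zq)_n (cq)_n} = z \sum_{n=1}^{N} \left[\begin{matrix} N \\ n\end{matrix}\right]\frac{(q)_n (cq)_{N-n} (cq)^n}{(zq)_n (cq)_N}. \end{equation*}
   Context: $|q|<1$; $(a)_n=(a;q)_n=(1-a)(1-aq)\cdots(1-aq^{n-1})$ with $(a)_0=1$. The $q$-binomial coefficient is $\left[\begin{matrix} N \\ n\end{matrix}\right]=\frac{(q)_N}{(q)_n(q)_{N-n}}$ for $0\le n\le N$ and $0$ otherwise. Parameters $z,c$ are complex with all denominators nonzero. -}

module Defs where

open import Level using (Level; suc; _⊔_)
open import Data.Nat as ℕ using (ℕ; zero; _≤?_; _∸_)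
import Data.Nat
open import Relation.Nullary using (¬_; yes; no)
open import Algebra.Bundles using (CommutativeRing)

-- A field: a commutative ring with 0 ≉ 1 and a (total) inverse map that is a
-- genuine multiplicative inverse on every nonzero element.  (The value of
-- 0 ⁻¹ is irrelevant; the statements below only divide by elements that are
-- assumed nonzero.)
record Field (a ℓ : Level) : Set (suc (a ⊔ ℓ)) where
  field
    commutativeRing : CommutativeRing a ℓ
  open CommutativeRing commutativeRing public
  field
    _⁻¹        : Carrier → Carrier
    0≉1        : ¬ (0# ≈ 1#)
    ⁻¹-inverse : ∀ x → ¬ (x ≈ 0#) → x * (x ⁻¹) ≈ 1#

module FieldOps {a ℓ : Level} (F : Field a ℓ) where
  open Field F

  infixl 7 _/_
  _/_ : Carrier → Carrier → Carrier
  x / y = x * (y ⁻¹)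

  pow : Carrier → ℕ → Carrier
  pow x zero       = 1#
  pow x (ℕ.suc n)  = pow x n * x

  poch : Carrier → Carrier → ℕ → Carrier
  poch x q zero      = 1#
  poch x q (ℕ.suc n) = poch x q n * (1# - x * pow q n)

  qbinom : Carrier → ℕ → ℕ → Carrier
  qbinom q N n with n ≤? N
  ... | yes _ = poch q q N / (poch q q n * poch q q (N ∸ n))
  ... | no  _ = 0#

  sum1 : ℕ → (ℕ → Carrier) → Carrier
  sum1 zero      f = 0#
  sum1 (ℕ.suc N) f = sum1 N f + f (ℕ.suc N)

-- Multiplying by (cq;q)_N and adding the n = 0 terms turns the claim into
--   Σ_n [N n] (q)_n/(zq)_n (zc)^n q^(n²) (cq^(n+1))_(N-n) − z Σ_n [N n] (q)_n/(zq)_n (cq)^n (cq)_(N-n)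
--     = (1 − z) (cq;q)_N.
-- Expand every Pochhammer symbol (x;q)_r by the q-binomial theorem and collect powers of c with
-- [N n][N-n j] = [N k][k n], k = n + j.  The coefficient of [N k] c^k is then a terminating
-- q-Chu–Vandermonde sum, equal to τ_k = (−1)^k q^(k(k+1)/2) (1 − z)/(1 − zq^k) in the first sum and
-- to q^k τ_k in the second.  As τ_k − z q^k τ_k = (1 − z)(−1)^k q^(k(k+1)/2), the difference is
-- (1 − z) Σ_k [N k] (−c)^k q^(k(k+1)/2) = (1 − z)(cq;q)_N, again by the q-binomial theorem.
-- The Chu–Vandermonde sums are products of q-difference operators applied to w^n (q)_n/(zq)_(n+j),
-- evaluated one factor at a time.
module Submission where

open import Level using (Level)
open import Algebra.Bundles using (CommutativeRing)
import Algebra.Properties.CommutativeSemigroup as CommSemigroupProperties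
import Algebra.Solver.Ring as RingSolver
import Algebra.Solver.Ring.AlmostCommutativeRing as ACR
open import Data.Integer as ℤ using (ℤ; +_; -[1+_]; _⊖_)
import Data.Integer.Properties as ℤ
open import Data.Maybe using (Maybe; just; nothing)
open import Data.Nat as ℕ using (ℕ; zero; suc; _≤_; _<_; _∸_; z≤n; s≤s)
import Data.Nat.Properties as ℕ
open import Data.Sign as Sign using (Sign)
open import Data.Sum using (inj₁; inj₂)
open import Function using (_∘_)
open import Relation.Binary.PropositionalEquality as ≡ using (_≡_)
open import Relation.Nullary using (¬_; yes; no; contradiction)

open import Defs

-- Algebra.Solver.Ring with integer coefficients, so that the solver can cancel terms such as x - x.
module ℤ-CoefficientSolver {c ℓ} (R : CommutativeRing c ℓ) where
  open CommutativeRing R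
  open import Relation.Binary.Reasoning.Setoid setoid
  open import Algebra.Properties.Semiring.Mult.TCOptimised semiring using (_×_; 1+×; ×-homo-+; ×1-homo-*)
  open import Algebra.Properties.Ring ring using (-1*x≈-x; -0#≈0#; -‿involutive; -‿+-comm)
  open CommSemigroupProperties +-commutativeSemigroup using () renaming (interchange to +-interchange)
  open CommSemigroupProperties *-commutativeSemigroup using () renaming (interchange to *-interchange)

  private
    -- The optimised _×_ makes fromℤ (+ 1) reduce to 1#, so that :1 denotes 1# itself.
    fromℤ : ℤ → Carrier
    fromℤ (+ n)      = n × 1#
    fromℤ (-[1+ n ]) = - (suc n × 1#)

    ⊖-homo : ∀ m n → fromℤ (m ⊖ n) ≈ m × 1# - n × 1#
    ⊖-homo zero    zero    = sym (-‿inverseʳ 0#)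
    ⊖-homo zero    (suc n) = sym (+-identityˡ _)
    ⊖-homo (suc m) zero    = sym (trans (+-congˡ -0#≈0#) (+-identityʳ _))
    ⊖-homo (suc m) (suc n) = begin
      fromℤ (suc m ⊖ suc n)   ≡⟨ ≡.cong fromℤ (ℤ.[1+m]⊖[1+n]≡m⊖n m n) ⟩
      fromℤ (m ⊖ n)           ≈⟨ ⊖-homo m n ⟩
      a - b                   ≈⟨ +-identityˡ _ ⟨
      0# + (a - b)            ≈⟨ +-congʳ (-‿inverseʳ 1#) ⟨
      (1# - 1#) + (a - b)     ≈⟨ +-interchange 1# (- 1#) a (- b) ⟩
      (1# + a) + (- 1# - b)   ≈⟨ +-congˡ (-‿+-comm 1# b) ⟩
      (1# + a) - (1# + b)     ≈⟨ +-cong (1+× m 1#) (-‿cong (1+× n 1#)) ⟨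
      suc m × 1# - suc n × 1# ∎
      where a = m × 1#; b = n × 1#

    +-homo : ∀ i j → fromℤ (i ℤ.+ j) ≈ fromℤ i + fromℤ j
    +-homo (+ m)    (+ n)    = ×-homo-+ 1# m n
    +-homo (+ m)    -[1+ n ] = ⊖-homo m (suc n)
    +-homo -[1+ m ] (+ n)    = trans (⊖-homo n (suc m)) (+-comm _ _)
    +-homo -[1+ m ] -[1+ n ] = begin
      - (suc (suc (m ℕ.+ n)) × 1#)  ≡⟨ ≡.cong (λ k → - (suc k × 1#)) (ℕ.+-suc m n) ⟨
      - ((suc m ℕ.+ suc n) × 1#)    ≈⟨ -‿cong (×-homo-+ 1# (suc m) (suc n)) ⟩
      - (suc m × 1# + suc n × 1#)   ≈⟨ -‿+-comm _ _ ⟨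
      - (suc m × 1#) - (suc n × 1#) ∎

    -‿homo : ∀ i → fromℤ (ℤ.- i) ≈ - fromℤ i
    -‿homo (+ zero)  = sym -0#≈0#
    -‿homo (+ suc n) = refl
    -‿homo -[1+ n ]  = sym (-‿involutive _)

    fromSign : Sign → Carrier
    fromSign Sign.+ = 1#
    fromSign Sign.- = - 1#

    ◃-homo : ∀ s n → fromℤ (s ℤ.◃ n) ≈ fromSign s * (n × 1#)
    ◃-homo Sign.+ n = trans (reflexive (≡.cong fromℤ (ℤ.+◃n≡+n n))) (sym (*-identityˡ _))
    ◃-homo Sign.- n = begin
      fromℤ (Sign.- ℤ.◃ n) ≡⟨ ≡.cong fromℤ (ℤ.-◃n≡-n n) ⟩
      fromℤ (ℤ.- (+ n))    ≈⟨ -‿homo (+ n) ⟩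
      - (n × 1#)           ≈⟨ -1*x≈-x _ ⟨
      - 1# * (n × 1#)      ∎

    sign-homo : ∀ s t → fromSign (s Sign.* t) ≈ fromSign s * fromSign t
    sign-homo Sign.+ t      = sym (*-identityˡ _)
    sign-homo Sign.- Sign.+ = sym (*-identityʳ _)
    sign-homo Sign.- Sign.- = sym (trans (-1*x≈-x (- 1#)) (-‿involutive 1#))

    sign-abs : ∀ i → fromℤ i ≈ fromSign (ℤ.sign i) * (ℤ.∣ i ∣ × 1#)
    sign-abs i = trans (reflexive (≡.cong fromℤ (≡.sym (ℤ.signᵢ◃∣i∣≡i i)))) (◃-homo (ℤ.sign i) ℤ.∣ i ∣)

    *-homo : ∀ i j → fromℤ (i ℤ.* j) ≈ fromℤ i * fromℤ j
    *-homo i j = begin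
      fromℤ (ℤ.sign i Sign.* ℤ.sign j ℤ.◃ ℤ.∣ i ∣ ℕ.* ℤ.∣ j ∣)
        ≈⟨ ◃-homo (ℤ.sign i Sign.* ℤ.sign j) (ℤ.∣ i ∣ ℕ.* ℤ.∣ j ∣) ⟩
      fromSign (ℤ.sign i Sign.* ℤ.sign j) * ((ℤ.∣ i ∣ ℕ.* ℤ.∣ j ∣) × 1#)
        ≈⟨ *-cong (sign-homo (ℤ.sign i) (ℤ.sign j)) (×1-homo-* ℤ.∣ i ∣ ℤ.∣ j ∣) ⟩
      (fromSign (ℤ.sign i) * fromSign (ℤ.sign j)) * ((ℤ.∣ i ∣ × 1#) * (ℤ.∣ j ∣ × 1#))
        ≈⟨ *-interchange _ _ _ _ ⟩
      (fromSign (ℤ.sign i) * (ℤ.∣ i ∣ × 1#)) * (fromSign (ℤ.sign j) * (ℤ.∣ j ∣ × 1#))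
        ≈⟨ *-cong (sign-abs i) (sign-abs j) ⟨
      fromℤ i * fromℤ j ∎

    homomorphism : ℤ.+-*-rawRing ACR.-Raw-AlmostCommutative⟶ ACR.fromCommutativeRing R
    homomorphism = record
      { ⟦_⟧ = fromℤ ; +-homo = +-homo ; *-homo = *-homo ; -‿homo = -‿homo
      ; 0-homo = refl ; 1-homo = refl }

    fromℤ-equal? : ∀ i j → Maybe (fromℤ i ≈ fromℤ j)
    fromℤ-equal? i j with i ℤ.≟ j
    ... | yes ≡.refl = just refl
    ... | no  _      = nothing

  open RingSolver ℤ.+-*-rawRing (ACR.fromCommutativeRing R) homomorphism fromℤ-equal? public

  :1 : ∀ {n} → Polynomial n
  :1 = con (+ 1)

module QSeries {a ℓ} (F : Field a ℓ) where
  open Field F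
  open FieldOps F
  open ℤ-CoefficientSolver commutativeRing
  open import Relation.Binary.Reasoning.Setoid setoid
  open CommSemigroupProperties +-commutativeSemigroup using () renaming (interchange to +-interchange)
  open CommSemigroupProperties *-commutativeSemigroup using (x∙yz≈y∙xz; x∙yz≈yx∙z; xy∙z≈xz∙y)
    renaming (interchange to *-interchange)

  ⁻¹-inverseˡ : ∀ {x} → x ≉ 0# → x ⁻¹ * x ≈ 1#
  ⁻¹-inverseˡ {x} x≉0 = trans (*-comm _ _) (⁻¹-inverse x x≉0)

  ⁻¹-unique : ∀ {x y} → x ≉ 0# → x * y ≈ 1# → x ⁻¹ ≈ y
  ⁻¹-unique {x} {y} x≉0 xy≈1 = begin
    x ⁻¹             ≈⟨ *-identityʳ _ ⟨
    x ⁻¹ * 1#        ≈⟨ *-congˡ xy≈1 ⟨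
    x ⁻¹ * (x * y)   ≈⟨ *-assoc _ _ _ ⟨
    (x ⁻¹ * x) * y   ≈⟨ *-congʳ (⁻¹-inverseˡ x≉0) ⟩
    1# * y           ≈⟨ *-identityˡ y ⟩
    y                ∎

  *-cancelˡ : ∀ {c x y} → c ≉ 0# → c * x ≈ c * y → x ≈ y
  *-cancelˡ {c} {x} {y} c≉0 cx≈cy = begin
    x                ≈⟨ *-identityˡ x ⟨
    1# * x           ≈⟨ *-congʳ (⁻¹-inverseˡ c≉0) ⟨
    (c ⁻¹ * c) * x   ≈⟨ *-assoc _ _ _ ⟩
    c ⁻¹ * (c * x)   ≈⟨ *-congˡ cx≈cy ⟩
    c ⁻¹ * (c * y)   ≈⟨ *-assoc _ _ _ ⟨
    (c ⁻¹ * c) * y   ≈⟨ *-congʳ (⁻¹-inverseˡ c≉0) ⟩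
    1# * y           ≈⟨ *-identityˡ y ⟩
    y                ∎

  *-≉0 : ∀ {x y} → x ≉ 0# → y ≉ 0# → x * y ≉ 0#
  *-≉0 {x} {y} x≉0 y≉0 xy≈0 = y≉0 (*-cancelˡ x≉0 (trans xy≈0 (sym (zeroʳ x))))

  ⁻¹-distrib-* : ∀ {x y} → x ≉ 0# → y ≉ 0# → (x * y) ⁻¹ ≈ x ⁻¹ * y ⁻¹
  ⁻¹-distrib-* {x} {y} x≉0 y≉0 = ⁻¹-unique (*-≉0 x≉0 y≉0) (begin
    (x * y) * (x ⁻¹ * y ⁻¹)   ≈⟨ *-interchange x y (x ⁻¹) (y ⁻¹) ⟩
    (x * x ⁻¹) * (y * y ⁻¹)   ≈⟨ *-cong (⁻¹-inverse x x≉0) (⁻¹-inverse y y≉0) ⟩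
    1# * 1#                   ≈⟨ *-identityˡ 1# ⟩
    1#                        ∎)

  1⁻¹≈1 : 1# ⁻¹ ≈ 1#
  1⁻¹≈1 = ⁻¹-unique (λ 1≈0 → 0≉1 (sym 1≈0)) (*-identityˡ 1#)

  x⁻¹≈y[xy]⁻¹ : ∀ {x y} → x * y ≉ 0# → x ⁻¹ ≈ y * (x * y) ⁻¹
  x⁻¹≈y[xy]⁻¹ {x} {y} xy≉0 = ⁻¹-unique (λ x≈0 → xy≉0 (trans (*-congʳ x≈0) (zeroˡ y)))
    (trans (sym (*-assoc _ _ _)) (⁻¹-inverse (x * y) xy≉0))

  pow-+ : ∀ x m n → pow x (m ℕ.+ n) ≈ pow x m * pow x n
  pow-+ x zero    n = sym (*-identityˡ _)
  pow-+ x (suc m) n = begin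
    pow x (m ℕ.+ n) * x          ≈⟨ *-congʳ (pow-+ x m n) ⟩
    (pow x m * pow x n) * x      ≈⟨ solve 3 (λ a b c → (a :* b) :* c := (a :* c) :* b) refl (pow x m) (pow x n) x ⟩
    (pow x m * x) * pow x n      ∎

  pow-distrib-* : ∀ x y n → pow (x * y) n ≈ pow x n * pow y n
  pow-distrib-* x y zero    = sym (*-identityˡ _)
  pow-distrib-* x y (suc n) = trans (*-congʳ (pow-distrib-* x y n)) (*-interchange _ _ _ _)

  pow-pow : ∀ x m n → pow (pow x m) n ≈ pow x (m ℕ.* n)
  pow-pow x m zero    = reflexive (≡.cong (pow x) (≡.sym (ℕ.*-zeroʳ m)))
  pow-pow x m (suc n) = begin
    pow (pow x m) n * pow x m     ≈⟨ *-congʳ (pow-pow x m n) ⟩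
    pow x (m ℕ.* n) * pow x m     ≈⟨ *-comm _ _ ⟩
    pow x m * pow x (m ℕ.* n)     ≈⟨ pow-+ x m (m ℕ.* n) ⟨
    pow x (m ℕ.+ m ℕ.* n)         ≡⟨ ≡.cong (pow x) (ℕ.*-suc m n) ⟨
    pow x (m ℕ.* suc n)           ∎

  pow-1# : ∀ n → pow 1# n ≈ 1#
  pow-1# zero    = refl
  pow-1# (suc n) = trans (*-identityʳ _) (pow-1# n)

  sum0 : ℕ → (ℕ → Carrier) → Carrier
  sum0 N f = f 0 + sum1 N f

  sum1-sucˡ : ∀ N f → sum1 (suc N) f ≈ f 1 + sum1 N (f ∘ suc)
  sum1-sucˡ zero    f = trans (+-identityˡ _) (sym (+-identityʳ _))
  sum1-sucˡ (suc N) f = trans (+-congʳ (sum1-sucˡ N f)) (+-assoc _ _ _)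

  sum0-sucˡ : ∀ N f → sum0 (suc N) f ≈ f 0 + sum0 N (f ∘ suc)
  sum0-sucˡ N f = +-congˡ (sum1-sucˡ N f)

  sum1-cong : ∀ N {f g : ℕ → Carrier} → (∀ n → n ≤ N → f n ≈ g n) → sum1 N f ≈ sum1 N g
  sum1-cong zero    f≈g = refl
  sum1-cong (suc N) f≈g = +-cong (sum1-cong N (λ n n≤N → f≈g n (ℕ.m≤n⇒m≤1+n n≤N))) (f≈g (suc N) ℕ.≤-refl)

  sum0-cong : ∀ N {f g : ℕ → Carrier} → (∀ n → n ≤ N → f n ≈ g n) → sum0 N f ≈ sum0 N g
  sum0-cong N f≈g = +-cong (f≈g 0 z≤n) (sum1-cong N f≈g)

  sum1-+ : ∀ N (f g : ℕ → Carrier) → sum1 N (λ n → f n + g n) ≈ sum1 N f + sum1 N g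
  sum1-+ zero    f g = sym (+-identityʳ _)
  sum1-+ (suc N) f g = trans (+-congʳ (sum1-+ N f g)) (+-interchange _ _ _ _)

  sum0-+ : ∀ N (f g : ℕ → Carrier) → sum0 N (λ n → f n + g n) ≈ sum0 N f + sum0 N g
  sum0-+ N f g = trans (+-congˡ (sum1-+ N f g)) (+-interchange _ _ _ _)

  *-distribˡ-sum1 : ∀ N c (f : ℕ → Carrier) → c * sum1 N f ≈ sum1 N (λ n → c * f n)
  *-distribˡ-sum1 zero    c f = zeroʳ c
  *-distribˡ-sum1 (suc N) c f = trans (distribˡ _ _ _) (+-congʳ (*-distribˡ-sum1 N c f))

  P*s≈P*zs′ : ∀ {P L R s s′} z → L ≈ P + P * s → R ≈ P + P * s′ → L + (- z) * R ≈ (1# - z) * P →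
              P * s ≈ P * (z * s′)
  P*s≈P*zs′ {P} {L} {R} {s} {s′} z L≈ R≈ L-zR≈ = begin
    P * s
      ≈⟨ solve 4 (λ P s s′ z → P :* s :=
                   ((P :+ P :* s) :+ (:- z) :* (P :+ P :* s′)) :- (:1 :- z) :* P :+ P :* (z :* s′))
                 refl P s s′ z ⟩
    ((P + P * s) + (- z) * (P + P * s′)) - (1# - z) * P + P * (z * s′)
      ≈⟨ +-congʳ (+-congʳ (+-cong (sym L≈) (*-congˡ (sym R≈)))) ⟩
    (L + (- z) * R) - (1# - z) * P + P * (z * s′)
      ≈⟨ +-congʳ (+-congʳ L-zR≈) ⟩
    (1# - z) * P - (1# - z) * P + P * (z * s′)
      ≈⟨ solve 3 (λ z P t → (:1 :- z) :* P :- (:1 :- z) :* P :+ t := t) refl z P (P * (z * s′)) ⟩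
    P * (z * s′) ∎

  module _ (q : Carrier) where

    poch-cong : ∀ {x y} n → x ≈ y → poch x q n ≈ poch y q n
    poch-cong zero    x≈y = refl
    poch-cong (suc n) x≈y = *-cong (poch-cong n x≈y) (+-congˡ (-‿cong (*-congʳ x≈y)))

    poch-unfoldˡ : ∀ x n → poch x q (suc n) ≈ (1# - x) * poch (x * q) q n
    poch-unfoldˡ x zero    = solve 1 (λ x → :1 :* (:1 :- x :* :1) := (:1 :- x) :* :1) refl x
    poch-unfoldˡ x (suc n) = begin
      poch x q (suc n) * (1# - x * (pow q n * q))
        ≈⟨ *-congʳ (poch-unfoldˡ x n) ⟩
      ((1# - x) * poch (x * q) q n) * (1# - x * (pow q n * q))
        ≈⟨ solve 4 (λ p x q qⁿ → ((:1 :- x) :* p) :* (:1 :- x :* (qⁿ :* q)) := (:1 :- x) :* (p :* (:1 :- (x :* q) :* qⁿ)))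
                   refl (poch (x * q) q n) x q (pow q n) ⟩
      (1# - x) * poch (x * q) q (suc n) ∎

    poch-+ : ∀ x m n → poch x q (m ℕ.+ n) ≈ poch x q m * poch (x * pow q m) q n
    poch-+ x m zero    = trans (reflexive (≡.cong (poch x q) (ℕ.+-identityʳ m))) (sym (*-identityʳ _))
    poch-+ x m (suc n) = begin
      poch x q (m ℕ.+ suc n)
        ≡⟨ ≡.cong (poch x q) (ℕ.+-suc m n) ⟩
      poch x q (m ℕ.+ n) * (1# - x * pow q (m ℕ.+ n))
        ≈⟨ *-cong (poch-+ x m n) (+-congˡ (-‿cong (*-congˡ (pow-+ q m n)))) ⟩
      (poch x q m * poch (x * pow q m) q n) * (1# - x * (pow q m * pow q n))
        ≈⟨ solve 5 (λ a b x u v → (a :* b) :* (:1 :- x :* (u :* v)) := a :* (b :* (:1 :- (x :* u) :* v)))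
                   refl (poch x q m) (poch (x * pow q m) q n) x (pow q m) (pow q n) ⟩
      poch x q m * poch (x * pow q m) q (suc n) ∎

    -- gaussianSum k f = Σ_{n+j=k} [k n] f n j, by the q-Pascal rule [k+1 n] = q^n [k n] + [k n-1].
    gaussianSum : ℕ → (ℕ → ℕ → Carrier) → Carrier
    gaussianSum zero    f = f 0 0
    gaussianSum (suc k) f = gaussianSum k (λ n j → pow q n * f n (suc j)) + gaussianSum k (λ n j → f (suc n) j)

    gaussianSum-cong : ∀ k {f g : ℕ → ℕ → Carrier} → (∀ n j → n ℕ.+ j ≡ k → f n j ≈ g n j) →
                       gaussianSum k f ≈ gaussianSum k g
    gaussianSum-cong zero    f≈g = f≈g 0 0 ≡.refl
    gaussianSum-cong (suc k) f≈g = +-cong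
      (gaussianSum-cong k (λ n j n+j≡k → *-congˡ (f≈g n (suc j) (≡.trans (ℕ.+-suc n j) (≡.cong suc n+j≡k)))))
      (gaussianSum-cong k (λ n j n+j≡k → f≈g (suc n) j (≡.cong suc n+j≡k)))

    gaussianSum-+ : ∀ k (f g : ℕ → ℕ → Carrier) →
                    gaussianSum k (λ n j → f n j + g n j) ≈ gaussianSum k f + gaussianSum k g
    gaussianSum-+ zero    f g = refl
    gaussianSum-+ (suc k) f g = trans
      (+-cong (trans (gaussianSum-cong k (λ n j _ → distribˡ _ _ _)) (gaussianSum-+ k _ _)) (gaussianSum-+ k _ _))
      (+-interchange _ _ _ _)

    *-distribˡ-gaussianSum : ∀ k c (f : ℕ → ℕ → Carrier) →
                             c * gaussianSum k f ≈ gaussianSum k (λ n j → c * f n j)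
    *-distribˡ-gaussianSum zero    c f = refl
    *-distribˡ-gaussianSum (suc k) c f = begin
      c * (gaussianSum k (λ n j → pow q n * f n (suc j)) + gaussianSum k (λ n j → f (suc n) j))
        ≈⟨ distribˡ _ _ _ ⟩
      c * gaussianSum k (λ n j → pow q n * f n (suc j)) + c * gaussianSum k (λ n j → f (suc n) j)
        ≈⟨ +-cong (*-distribˡ-gaussianSum k c _) (*-distribˡ-gaussianSum k c _) ⟩
      gaussianSum k (λ n j → c * (pow q n * f n (suc j))) + gaussianSum k (λ n j → c * f (suc n) j)
        ≈⟨ +-congʳ (gaussianSum-cong k (λ n j _ → x∙yz≈y∙xz c (pow q n) (f n (suc j)))) ⟩
      gaussianSum (suc k) (λ n j → c * f n j) ∎

    cauchyTerm : Carrier → ℕ → Carrier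
    cauchyTerm x zero    = 1#
    cauchyTerm x (suc j) = cauchyTerm x j * (- (x * pow q j))

    cauchyTerm-cong : ∀ {x y} j → x ≈ y → cauchyTerm x j ≈ cauchyTerm y j
    cauchyTerm-cong zero    x≈y = refl
    cauchyTerm-cong (suc j) x≈y = *-cong (cauchyTerm-cong j x≈y) (-‿cong (*-congʳ x≈y))

    cauchyTerm-* : ∀ y x j → cauchyTerm (y * x) j ≈ pow y j * cauchyTerm x j
    cauchyTerm-* y x zero    = sym (*-identityˡ _)
    cauchyTerm-* y x (suc j) = trans (*-congʳ (cauchyTerm-* y x j))
      (solve 5 (λ yʲ t y x qʲ → (yʲ :* t) :* (:- ((y :* x) :* qʲ)) := (yʲ :* y) :* (t :* (:- (x :* qʲ))))
             refl (pow y j) (cauchyTerm x j) y x (pow q j))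

    q-binomial-theorem : ∀ r x → poch x q r ≈ gaussianSum r (λ n _ → cauchyTerm x n)
    q-binomial-theorem zero    x = refl
    q-binomial-theorem (suc r) x = begin
      poch x q (suc r)                                 ≈⟨ poch-unfoldˡ x r ⟩
      (1# - x) * poch (x * q) q r                      ≈⟨ *-congˡ (q-binomial-theorem r (x * q)) ⟩
      (1# - x) * S                                     ≈⟨ solve 2 (λ x S → (:1 :- x) :* S := S :+ (:- x) :* S) refl x S ⟩
      S + (- x) * S                                    ≈⟨ +-cong (gaussianSum-cong r (λ n _ _ → shift n))
                                                                 (trans (*-distribˡ-gaussianSum r (- x) _)
                                                                        (gaussianSum-cong r (λ n _ _ → step n))) ⟩
      gaussianSum (suc r) (λ n _ → cauchyTerm x n)     ∎
      where
      S = gaussianSum r (λ n _ → cauchyTerm (x * q) n)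
      shift : ∀ n → cauchyTerm (x * q) n ≈ pow q n * cauchyTerm x n
      shift n = trans (cauchyTerm-cong n (*-comm x q)) (cauchyTerm-* q x n)
      step : ∀ n → (- x) * cauchyTerm (x * q) n ≈ cauchyTerm x (suc n)
      step n = trans (*-congˡ (shift n))
        (solve 3 (λ x qⁿ t → (:- x) :* (qⁿ :* t) := t :* (:- (x :* qⁿ))) refl x (pow q n) (cauchyTerm x n))

    qⁿqʲ≈qᵏ : ∀ n j {k} → n ℕ.+ j ≡ k → pow q n * pow q j ≈ pow q k
    qⁿqʲ≈qᵏ n j n+j≡k = trans (sym (pow-+ q n j)) (reflexive (≡.cong (pow q) n+j≡k))

    -- The q-analogue of splitting a multinomial: [N n][N-n j] = [N n+j][n+j n].
    gaussianSum-nested : ∀ N (U : ℕ → Carrier) (W : ℕ → ℕ → ℕ → Carrier) →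
      gaussianSum N (λ n r → U n * gaussianSum r (W n)) ≈
      gaussianSum N (λ k t → gaussianSum k (λ n j → U n * W n j t))
    gaussianSum-nested zero    U W = refl
    gaussianSum-nested (suc N) U W = begin
      gaussianSum N (λ n r → pow q n * (U n * gaussianSum (suc r) (W n)))
        + gaussianSum N (λ n r → U (suc n) * gaussianSum r (W (suc n)))
        ≈⟨ +-congʳ (trans (gaussianSum-cong N (λ n r _ → trans (sym (*-assoc _ _ _)) (distribˡ _ _ _)))
                          (gaussianSum-+ N _ _)) ⟩
      (gaussianSum N (λ n r → (pow q n * U n) * gaussianSum r (λ j t → pow q j * W n j (suc t)))
        + gaussianSum N (λ n r → (pow q n * U n) * gaussianSum r (λ j t → W n (suc j) t)))
        + gaussianSum N (λ n r → U (suc n) * gaussianSum r (W (suc n)))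
        ≈⟨ +-cong (+-cong (gaussianSum-nested N _ _) (gaussianSum-nested N _ _)) (gaussianSum-nested N _ _) ⟩
      (gaussianSum N (λ k t → gaussianSum k (λ n j → (pow q n * U n) * (pow q j * W n j (suc t))))
        + gaussianSum N (λ k t → gaussianSum k (λ n j → (pow q n * U n) * W n (suc j) t)))
        + gaussianSum N (λ k t → gaussianSum k (λ n j → U (suc n) * W (suc n) j t))
        ≈⟨ +-congʳ (+-cong (gaussianSum-cong N (λ k t _ → collect k t))
                           (gaussianSum-cong N (λ k t _ → gaussianSum-cong k (λ n j _ → *-assoc _ _ _)))) ⟩
      (gaussianSum N (λ k t → pow q k * gaussianSum k (λ n j → U n * W n j (suc t)))
        + gaussianSum N (λ k t → gaussianSum k (λ n j → pow q n * (U n * W n (suc j) t))))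
        + gaussianSum N (λ k t → gaussianSum k (λ n j → U (suc n) * W (suc n) j t))
        ≈⟨ trans (+-assoc _ _ _) (+-congˡ (sym (gaussianSum-+ N _ _))) ⟩
      gaussianSum (suc N) (λ k t → gaussianSum k (λ n j → U n * W n j t)) ∎
      where
      collect : ∀ k t → gaussianSum k (λ n j → (pow q n * U n) * (pow q j * W n j (suc t))) ≈
                        pow q k * gaussianSum k (λ n j → U n * W n j (suc t))
      collect k t = trans
        (gaussianSum-cong k (λ n j n+j≡k → trans (*-interchange _ _ _ _) (*-congʳ (qⁿqʲ≈qᵏ n j n+j≡k))))
        (sym (*-distribˡ-gaussianSum k (pow q k) _))

    -- qDiff μ k h m = ((E - μ)(E - μq)⋯(E - μq^(k-1)) h)(m), where E is the shift h ↦ h ∘ suc.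
    qDiff : Carrier → ℕ → (ℕ → Carrier) → ℕ → Carrier
    qDiff μ k h m = gaussianSum k (λ n j → cauchyTerm μ j * h (m ℕ.+ n))

    qDiff-cong : ∀ μ k {h h′ : ℕ → Carrier} m → (∀ n → n ≤ k → h (m ℕ.+ n) ≈ h′ (m ℕ.+ n)) →
                 qDiff μ k h m ≈ qDiff μ k h′ m
    qDiff-cong μ k m h≈h′ = gaussianSum-cong k (λ n j n+j≡k → *-congˡ (h≈h′ n (≡.subst (n ≤_) n+j≡k (ℕ.m≤m+n n j))))

    qDiff-+ : ∀ μ k (f g : ℕ → Carrier) m → qDiff μ k (λ n → f n + g n) m ≈ qDiff μ k f m + qDiff μ k g m
    qDiff-+ μ k f g m = trans (gaussianSum-cong k (λ n j _ → distribˡ _ _ _)) (gaussianSum-+ k _ _)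

    *-distribˡ-qDiff : ∀ μ k c (h : ℕ → Carrier) m → c * qDiff μ k h m ≈ qDiff μ k (λ n → c * h n) m
    *-distribˡ-qDiff μ k c h m = trans (*-distribˡ-gaussianSum k c _)
      (gaussianSum-cong k (λ n j _ → x∙yz≈y∙xz c (cauchyTerm μ j) (h (m ℕ.+ n))))

    qDiff-suc : ∀ μ k h m → qDiff μ (suc k) h m ≈ qDiff μ k h (suc m) + (- (μ * pow q k)) * qDiff μ k h m
    qDiff-suc μ k h m = trans (+-comm _ _) (+-cong
      (gaussianSum-cong k (λ n j _ → reflexive (≡.cong (λ i → cauchyTerm μ j * h i) (ℕ.+-suc m n))))
      (trans (gaussianSum-cong k (λ n j n+j≡k → trans (lastFactor n j)
                                                      (*-congʳ (-‿cong (*-congˡ (qⁿqʲ≈qᵏ n j n+j≡k))))))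
             (sym (*-distribˡ-gaussianSum k _ _))))
      where
      lastFactor : ∀ n j → pow q n * (cauchyTerm μ (suc j) * h (m ℕ.+ n)) ≈
                           (- (μ * (pow q n * pow q j))) * (cauchyTerm μ j * h (m ℕ.+ n))
      lastFactor n j = solve 5 (λ qⁿ t μ qʲ x → qⁿ :* ((t :* (:- (μ :* qʲ))) :* x) := (:- (μ :* (qⁿ :* qʲ))) :* (t :* x))
                             refl (pow q n) (cauchyTerm μ j) μ (pow q j) (h (m ℕ.+ n))

    qDiff-suc-inside : ∀ μ k h m → qDiff μ (suc k) h m ≈ qDiff μ k (λ n → h (suc n) + (- (μ * pow q k)) * h n) m
    qDiff-suc-inside μ k h m = begin
      qDiff μ (suc k) h m                                     ≈⟨ qDiff-suc μ k h m ⟩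
      qDiff μ k h (suc m) + b * qDiff μ k h m                 ≈⟨ +-congˡ (*-distribˡ-qDiff μ k b h m) ⟩
      qDiff μ k (h ∘ suc) m + qDiff μ k (λ n → b * h n) m     ≈⟨ qDiff-+ μ k (h ∘ suc) (λ n → b * h n) m ⟨
      qDiff μ k (λ n → h (suc n) + b * h n) m                 ∎
      where b = - (μ * pow q k)

    qbinomRec : ℕ → ℕ → Carrier
    qbinomRec zero    zero    = 1#
    qbinomRec zero    (suc n) = 0#
    qbinomRec (suc N) zero    = 1#
    qbinomRec (suc N) (suc n) = pow q (suc n) * qbinomRec N (suc n) + qbinomRec N n

    qbinomRec-0 : ∀ N → qbinomRec N 0 ≈ 1#
    qbinomRec-0 zero    = refl
    qbinomRec-0 (suc N) = refl

    N<n⇒qbinomRec≈0 : ∀ N n → N < n → qbinomRec N n ≈ 0#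
    N<n⇒qbinomRec≈0 zero    (suc n) _         = refl
    N<n⇒qbinomRec≈0 (suc N) (suc n) (s≤s N<n) = begin
      pow q (suc n) * qbinomRec N (suc n) + qbinomRec N n
        ≈⟨ +-cong (*-congˡ (N<n⇒qbinomRec≈0 N (suc n) (ℕ.m≤n⇒m≤1+n N<n))) (N<n⇒qbinomRec≈0 N n N<n) ⟩
      pow q (suc n) * 0# + 0#   ≈⟨ +-identityʳ _ ⟩
      pow q (suc n) * 0#        ≈⟨ zeroʳ _ ⟩
      0#                        ∎

    qbinomRec-diag : ∀ N → qbinomRec N N ≈ 1#
    qbinomRec-diag zero    = refl
    qbinomRec-diag (suc N) = begin
      pow q (suc N) * qbinomRec N (suc N) + qbinomRec N N
        ≈⟨ +-cong (trans (*-congˡ (N<n⇒qbinomRec≈0 N (suc N) (ℕ.n<1+n N))) (zeroʳ _)) (qbinomRec-diag N) ⟩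
      0# + 1#   ≈⟨ +-identityˡ 1# ⟩
      1#        ∎

    qbinomRec-factorial : ∀ m n → qbinomRec (m ℕ.+ n) m * (poch q q m * poch q q n) ≈ poch q q (m ℕ.+ n)
    qbinomRec-factorial zero    n    = trans (*-congʳ (qbinomRec-0 n)) (trans (*-identityˡ _) (*-identityˡ _))
    qbinomRec-factorial (suc m) zero rewrite ℕ.+-identityʳ m =
      trans (*-cong (qbinomRec-diag (suc m)) (*-identityʳ _)) (*-identityˡ _)
    qbinomRec-factorial (suc m) (suc n) = begin
      (qᵐ⁺¹ * A + B) * ((Pₘ * (1# - q * qᵐ)) * (Pₙ * (1# - q * qⁿ)))
        ≈⟨ solve 8 (λ qᵐ⁺¹ A B Pₘ Pₙ q qᵐ qⁿ →
                     (qᵐ⁺¹ :* A :+ B) :* ((Pₘ :* (:1 :- q :* qᵐ)) :* (Pₙ :* (:1 :- q :* qⁿ))) :=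
                     qᵐ⁺¹ :* (:1 :- q :* qⁿ) :* (A :* ((Pₘ :* (:1 :- q :* qᵐ)) :* Pₙ))
                       :+ (:1 :- q :* qᵐ) :* (B :* (Pₘ :* (Pₙ :* (:1 :- q :* qⁿ)))))
                   refl qᵐ⁺¹ A B Pₘ Pₙ q qᵐ qⁿ ⟩
      qᵐ⁺¹ * (1# - q * qⁿ) * (A * ((Pₘ * (1# - q * qᵐ)) * Pₙ)) + (1# - q * qᵐ) * (B * (Pₘ * (Pₙ * (1# - q * qⁿ))))
        ≈⟨ +-cong (*-congˡ lowerRow) (*-congˡ (qbinomRec-factorial m (suc n))) ⟩
      qᵐ⁺¹ * (1# - q * qⁿ) * P + (1# - q * qᵐ) * P
        ≈⟨ solve 5 (λ qᵐ q qⁿ P qᵐ⁺ⁿ⁺¹ → (qᵐ :* q) :* (:1 :- q :* qⁿ) :* P :+ (:1 :- q :* qᵐ) :* P :=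
                                         P :* (:1 :- q :* qᵐ⁺ⁿ⁺¹) :+ P :* q :* (qᵐ⁺ⁿ⁺¹ :- qᵐ :* (qⁿ :* q)))
                   refl qᵐ q qⁿ P (pow q (m ℕ.+ suc n)) ⟩
      P * (1# - q * pow q (m ℕ.+ suc n)) + P * q * (pow q (m ℕ.+ suc n) - qᵐ * (qⁿ * q))
        ≈⟨ +-congˡ (trans (*-congˡ (+-congˡ (-‿cong (sym (pow-+ q m (suc n)))))) (trans (*-congˡ (-‿inverseʳ _)) (zeroʳ _))) ⟩
      P * (1# - q * pow q (m ℕ.+ suc n)) + 0#
        ≈⟨ +-identityʳ _ ⟩
      poch q q (suc m ℕ.+ suc n) ∎
      where
      qᵐ = pow q m
      qⁿ = pow q n
      qᵐ⁺¹ = pow q (suc m)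
      Pₘ = poch q q m
      Pₙ = poch q q n
      P = poch q q (m ℕ.+ suc n)
      A = qbinomRec (m ℕ.+ suc n) (suc m)
      B = qbinomRec (m ℕ.+ suc n) m
      lowerRow : A * ((Pₘ * (1# - q * qᵐ)) * Pₙ) ≈ P
      lowerRow = ≡.subst (λ i → qbinomRec i (suc m) * (poch q q (suc m) * Pₙ) ≈ poch q q i)
                         (≡.sym (ℕ.+-suc m n)) (qbinomRec-factorial (suc m) n)

    qbinom≈qbinomRec : ∀ N n → n ≤ N → (∀ k → k ≤ N → poch q q k ≉ 0#) → qbinom q N n ≈ qbinomRec N n
    qbinom≈qbinomRec N n n≤N Pₖ≉0 with n ℕ.≤? N
    ... | no n≰N = contradiction n≤N n≰N
    ... | yes _  = begin
      poch q q N * D ⁻¹                    ≈⟨ *-congʳ factorial ⟨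
      (qbinomRec N n * D) * D ⁻¹           ≈⟨ *-assoc _ _ _ ⟩
      qbinomRec N n * (D * D ⁻¹)           ≈⟨ *-congˡ (⁻¹-inverse D (*-≉0 (Pₖ≉0 n n≤N) (Pₖ≉0 (N ∸ n) (ℕ.m∸n≤m N n)))) ⟩
      qbinomRec N n * 1#                   ≈⟨ *-identityʳ _ ⟩
      qbinomRec N n                        ∎
      where
      D = poch q q n * poch q q (N ∸ n)
      factorial : qbinomRec N n * D ≈ poch q q N
      factorial = ≡.subst (λ i → qbinomRec i n * D ≈ poch q q i) (ℕ.m+[n∸m]≡n n≤N) (qbinomRec-factorial n (N ∸ n))

    sum0-shift : ∀ N f → f (suc N) ≈ 0# → sum0 N f ≈ f 0 + sum0 N (f ∘ suc)
    sum0-shift N f fN+1≈0 = begin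
      sum0 N f                   ≈⟨ +-identityʳ _ ⟨
      sum0 N f + 0#              ≈⟨ +-congˡ fN+1≈0 ⟨
      sum0 N f + f (suc N)       ≈⟨ +-assoc _ _ _ ⟩
      sum0 (suc N) f             ≈⟨ sum0-sucˡ N f ⟩
      f 0 + sum0 N (f ∘ suc)     ∎

    gaussianSum≈sum0 : ∀ N (F : ℕ → ℕ → Carrier) → gaussianSum N F ≈ sum0 N (λ n → qbinomRec N n * F n (N ∸ n))
    gaussianSum≈sum0 zero    F = sym (trans (+-identityʳ _) (*-identityˡ _))
    gaussianSum≈sum0 (suc N) F = begin
      gaussianSum N (λ n j → pow q n * F n (suc j)) + gaussianSum N (λ n j → F (suc n) j)
        ≈⟨ +-cong (gaussianSum≈sum0 N _) (gaussianSum≈sum0 N _) ⟩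
      sum0 N (λ n → qbinomRec N n * (pow q n * F n (suc (N ∸ n)))) + sum0 N (λ n → qbinomRec N n * F (suc n) (N ∸ n))
        ≈⟨ +-congʳ (sum0-shift N _ (trans (*-congʳ (N<n⇒qbinomRec≈0 N (suc N) (ℕ.n<1+n N))) (zeroˡ _))) ⟩
      (qbinomRec N 0 * (1# * F 0 (suc N))
         + sum0 N (λ n → qbinomRec N (suc n) * (pow q (suc n) * F (suc n) (suc (N ∸ suc n)))))
        + sum0 N (λ n → qbinomRec N n * F (suc n) (N ∸ n))
        ≈⟨ +-congʳ (+-cong (*-congʳ (qbinomRec-0 N)) (sum0-cong N upperRow)) ⟩
      (1# * (1# * F 0 (suc N)) + sum0 N (λ n → (pow q (suc n) * qbinomRec N (suc n)) * F (suc n) (N ∸ n)))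
        + sum0 N (λ n → qbinomRec N n * F (suc n) (N ∸ n))
        ≈⟨ +-assoc _ _ _ ⟩
      1# * (1# * F 0 (suc N)) + (sum0 N (λ n → (pow q (suc n) * qbinomRec N (suc n)) * F (suc n) (N ∸ n))
                                  + sum0 N (λ n → qbinomRec N n * F (suc n) (N ∸ n)))
        ≈⟨ +-cong (*-identityˡ _) (trans (sym (sum0-+ N _ _)) (sum0-cong N (λ n _ → sym (distribʳ _ _ _)))) ⟩
      1# * F 0 (suc N) + sum0 N (λ n → qbinomRec (suc N) (suc n) * F (suc n) (N ∸ n))
        ≈⟨ sum0-sucˡ N _ ⟨
      sum0 (suc N) (λ n → qbinomRec (suc N) n * F n (suc N ∸ n)) ∎
      where
      upperRow : ∀ n → n ≤ N → qbinomRec N (suc n) * (pow q (suc n) * F (suc n) (suc (N ∸ suc n))) ≈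
                                (pow q (suc n) * qbinomRec N (suc n)) * F (suc n) (N ∸ n)
      upperRow n n≤N with ℕ.m≤n⇒m<n∨m≡n n≤N
      ... | inj₁ n<N    = trans (x∙yz≈yx∙z _ _ _) (*-congˡ (reflexive (≡.cong (F (suc n)) (≡.sym (ℕ.+-∸-assoc 1 n<N)))))
      ... | inj₂ ≡.refl = begin
        qbinomRec N (suc N) * (pow q (suc N) * F (suc N) (suc (N ∸ suc N)))  ≈⟨ *-congʳ vanish ⟩
        0# * (pow q (suc N) * F (suc N) (suc (N ∸ suc N)))                   ≈⟨ zeroˡ _ ⟩
        0#                                                                    ≈⟨ zeroˡ _ ⟨
        0# * F (suc N) (N ∸ N)                                                ≈⟨ *-congʳ (trans (*-congˡ vanish) (zeroʳ _)) ⟨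
        (pow q (suc N) * qbinomRec N (suc N)) * F (suc N) (N ∸ N)             ∎
        where vanish = N<n⇒qbinomRec≈0 N (suc N) (ℕ.n<1+n N)

    module _ (z : Carrier) (N : ℕ) (Pzq≉0 : ∀ n → n ≤ N → poch (z * q) q n ≉ 0#) where

      poch⁻¹-suc : ∀ t → suc t ≤ N → poch (z * q) q t ⁻¹ ≈ (1# - (z * q) * pow q t) * poch (z * q) q (suc t) ⁻¹
      poch⁻¹-suc t t<N = x⁻¹≈y[xy]⁻¹ (Pzq≉0 (suc t) t<N)

      term : Carrier → ℕ → ℕ → Carrier
      term w j n = pow w n * poch q q n * poch (z * q) q (n ℕ.+ j) ⁻¹

      term-shift : ∀ w j n → suc (n ℕ.+ j) ≤ N →
                   term w j n ≈ pow w n * poch q q n *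
                                ((1# - (z * q) * (pow q n * pow q j)) * poch (z * q) q (suc (n ℕ.+ j)) ⁻¹)
      term-shift w j n n+j<N =
        *-congˡ (trans (poch⁻¹-suc (n ℕ.+ j) n+j<N) (*-congʳ (+-congˡ (-‿cong (*-congˡ (pow-+ q n j))))))

      term-step-qʲ : ∀ j n → suc (n ℕ.+ j) ≤ N →
        term (pow q j) j (suc n) + (- (1# * pow q j)) * term (pow q j) j n ≈
        (- ((1# - z * pow q j) * pow q (suc j))) * term (pow q (suc j)) (suc j) n
      term-step-qʲ j n n+j<N = begin
        term (pow q j) j (suc n) + (- (1# * qʲ)) * term (pow q j) j n
          ≈⟨ +-congˡ (*-congˡ (term-shift (pow q j) j n n+j<N)) ⟩
        (qʲⁿ * qʲ) * (Pₙ * (1# - q * qⁿ)) * I + (- (1# * qʲ)) * (qʲⁿ * Pₙ * ((1# - (z * q) * (qⁿ * qʲ)) * I))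
          ≈⟨ solve 7 (λ qʲⁿ qʲ Pₙ q qⁿ I z →
                       (qʲⁿ :* qʲ) :* (Pₙ :* (:1 :- q :* qⁿ)) :* I
                         :+ (:- (:1 :* qʲ)) :* (qʲⁿ :* Pₙ :* ((:1 :- (z :* q) :* (qⁿ :* qʲ)) :* I))
                       := (:- ((:1 :- z :* qʲ) :* (qʲ :* q))) :* ((qʲⁿ :* qⁿ) :* Pₙ :* I))
                     refl qʲⁿ qʲ Pₙ q qⁿ I z ⟩
        (- ((1# - z * qʲ) * (qʲ * q))) * ((qʲⁿ * qⁿ) * Pₙ * I)
          ≈⟨ *-congˡ (*-cong (*-congʳ (pow-distrib-* qʲ q n))
                             (reflexive (≡.cong (λ t → poch (z * q) q t ⁻¹) (ℕ.+-suc n j)))) ⟨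
        (- ((1# - z * qʲ) * pow q (suc j))) * term (pow q (suc j)) (suc j) n ∎
        where
        qʲ = pow q j
        qʲⁿ = pow qʲ n
        qⁿ = pow q n
        Pₙ = poch q q n
        I = poch (z * q) q (suc (n ℕ.+ j)) ⁻¹

      term-step : ∀ w L j n → suc (n ℕ.+ j) ≤ N → w ≈ z * pow q j * L →
        term w j (suc n) + (- L) * term w j n ≈ (- (L * (1# - z * pow q j))) * term w (suc j) n
      term-step w L j n n+j<N w≈zqʲL = begin
        term w j (suc n) + (- L) * term w j n
          ≈⟨ +-cong (*-congʳ (*-congʳ (*-congˡ w≈zqʲL))) (*-congˡ (term-shift w j n n+j<N)) ⟩
        (wⁿ * (z * qʲ * L)) * (Pₙ * (1# - q * qⁿ)) * I + (- L) * (wⁿ * Pₙ * ((1# - (z * q) * (qⁿ * qʲ)) * I))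
          ≈⟨ solve 8 (λ wⁿ z qʲ L Pₙ q qⁿ I →
                       (wⁿ :* (z :* qʲ :* L)) :* (Pₙ :* (:1 :- q :* qⁿ)) :* I
                         :+ (:- L) :* (wⁿ :* Pₙ :* ((:1 :- (z :* q) :* (qⁿ :* qʲ)) :* I))
                       := (:- (L :* (:1 :- z :* qʲ))) :* (wⁿ :* Pₙ :* I))
                     refl wⁿ z qʲ L Pₙ q qⁿ I ⟩
        (- (L * (1# - z * qʲ))) * (wⁿ * Pₙ * I)
          ≈⟨ *-congˡ (*-congˡ (reflexive (≡.cong (λ t → poch (z * q) q t ⁻¹) (ℕ.+-suc n j)))) ⟨
        (- (L * (1# - z * qʲ))) * term w (suc j) n ∎
        where
        qʲ = pow q j
        wⁿ = pow w n
        qⁿ = pow q n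
        Pₙ = poch q q n
        I = poch (z * q) q (suc (n ℕ.+ j)) ⁻¹

      qDiff-1#-term : ∀ k m → k ℕ.+ m ≤ N →
                      qDiff 1# k (term 1# 0) m ≈ (cauchyTerm q k * poch z q k) * term (pow q k) k m
      qDiff-1#-term zero    m _   = begin
        1# * term 1# 0 (m ℕ.+ 0)     ≡⟨ ≡.cong (λ t → 1# * term 1# 0 t) (ℕ.+-identityʳ m) ⟩
        1# * term 1# 0 m             ≈⟨ *-congʳ (*-identityʳ 1#) ⟨
        (1# * 1#) * term 1# 0 m      ∎
      qDiff-1#-term (suc k) m k+m<N = begin
        qDiff 1# (suc k) (term 1# 0) m
          ≈⟨ qDiff-suc 1# k (term 1# 0) m ⟩
        qDiff 1# k (term 1# 0) (suc m) + (- (1# * qᵏ)) * qDiff 1# k (term 1# 0) m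
          ≈⟨ +-cong (qDiff-1#-term k (suc m) (≡.subst (_≤ N) (≡.sym (ℕ.+-suc k m)) k+m<N))
                    (*-congˡ (qDiff-1#-term k m (ℕ.<⇒≤ k+m<N))) ⟩
        C * term qᵏ k (suc m) + (- (1# * qᵏ)) * (C * term qᵏ k m)
          ≈⟨ solve 4 (λ C t₁ a t₀ → C :* t₁ :+ a :* (C :* t₀) := C :* (t₁ :+ a :* t₀))
                     refl C (term qᵏ k (suc m)) (- (1# * qᵏ)) (term qᵏ k m) ⟩
        C * (term qᵏ k (suc m) + (- (1# * qᵏ)) * term qᵏ k m)
          ≈⟨ *-congˡ (term-step-qʲ k m (≡.subst (λ t → suc t ≤ N) (ℕ.+-comm k m) k+m<N)) ⟩
        C * ((- ((1# - z * qᵏ) * (qᵏ * q))) * term (qᵏ * q) (suc k) m)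
          ≈⟨ solve 6 (λ c P qᵏ z q t → (c :* P) :* ((:- ((:1 :- z :* qᵏ) :* (qᵏ :* q))) :* t)
                                    := ((c :* (:- (q :* qᵏ))) :* (P :* (:1 :- z :* qᵏ))) :* t)
                     refl (cauchyTerm q k) (poch z q k) qᵏ z q (term (qᵏ * q) (suc k) m) ⟩
        (cauchyTerm q (suc k) * poch z q (suc k)) * term (pow q (suc k)) (suc k) m ∎
        where
        qᵏ = pow q k
        C = cauchyTerm q k * poch z q k

      qDiff-q-term : ∀ w k j → j ℕ.+ k ≤ N → w ≈ z * pow q j * pow q k →
                     qDiff q k (term w j) 0 ≈ (cauchyTerm q k * poch (z * pow q j) q k) * term w (j ℕ.+ k) 0
      qDiff-q-term w zero    j _ _ = begin
        1# * term w j 0                ≡⟨ ≡.cong (λ t → 1# * term w t 0) (ℕ.+-identityʳ j) ⟨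
        1# * term w (j ℕ.+ 0) 0        ≈⟨ *-congʳ (*-identityʳ 1#) ⟨
        (1# * 1#) * term w (j ℕ.+ 0) 0 ∎
      qDiff-q-term w (suc k) j j+k<N w≈zqʲqᵏ⁺¹ = begin
        qDiff q (suc k) (term w j) 0
          ≈⟨ qDiff-suc-inside q k (term w j) 0 ⟩
        qDiff q k (λ n → term w j (suc n) + (- (q * qᵏ)) * term w j n) 0
          ≈⟨ qDiff-cong q k 0 (λ n n≤k → term-step w (q * qᵏ) j n (bound n n≤k) (trans w≈zqʲqᵏ⁺¹ (*-congˡ (*-comm _ _)))) ⟩
        qDiff q k (λ n → (- ((q * qᵏ) * (1# - z * qʲ))) * term w (suc j) n) 0
          ≈⟨ *-distribˡ-qDiff q k _ (term w (suc j)) 0 ⟨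
        (- ((q * qᵏ) * (1# - z * qʲ))) * qDiff q k (term w (suc j)) 0
          ≈⟨ *-congˡ (qDiff-q-term w k (suc j) (≡.subst (_≤ N) (ℕ.+-suc j k) j+k<N) w≈zqʲ⁺¹qᵏ) ⟩
        (- ((q * qᵏ) * (1# - z * qʲ))) * ((cauchyTerm q k * poch (z * (qʲ * q)) q k) * term w (suc j ℕ.+ k) 0)
          ≈⟨ *-congˡ (*-cong (*-congˡ (poch-cong k (sym (*-assoc _ _ _))))
                             (reflexive (≡.cong (λ t → term w t 0) (≡.sym (ℕ.+-suc j k))))) ⟩
        (- ((q * qᵏ) * (1# - z * qʲ))) * ((cauchyTerm q k * poch (z * qʲ * q) q k) * term w (j ℕ.+ suc k) 0)
          ≈⟨ solve 7 (λ q qᵏ z qʲ c P t → (:- ((q :* qᵏ) :* (:1 :- z :* qʲ))) :* ((c :* P) :* t)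
                                        := (c :* (:- (q :* qᵏ))) :* ((:1 :- z :* qʲ) :* P) :* t)
                     refl q qᵏ z qʲ (cauchyTerm q k) (poch (z * qʲ * q) q k) (term w (j ℕ.+ suc k) 0) ⟩
        (cauchyTerm q (suc k) * ((1# - z * qʲ) * poch (z * qʲ * q) q k)) * term w (j ℕ.+ suc k) 0
          ≈⟨ *-congʳ (*-congˡ (poch-unfoldˡ (z * qʲ) k)) ⟨
        (cauchyTerm q (suc k) * poch (z * qʲ) q (suc k)) * term w (j ℕ.+ suc k) 0 ∎
        where
        qʲ = pow q j
        qᵏ = pow q k
        bound : ∀ n → n ≤ k → suc (n ℕ.+ j) ≤ N
        bound n n≤k = ℕ.≤-trans (s≤s (ℕ.+-monoˡ-≤ j n≤k))
                                (≡.subst (_≤ N) (≡.trans (ℕ.+-suc j k) (≡.cong suc (ℕ.+-comm j k))) j+k<N)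
        w≈zqʲ⁺¹qᵏ : w ≈ z * pow q (suc j) * qᵏ
        w≈zqʲ⁺¹qᵏ = trans w≈zqʲqᵏ⁺¹ (solve 4 (λ z qʲ qᵏ q → z :* qʲ :* (qᵏ :* q) := z :* (qʲ :* q) :* qᵏ) refl z qʲ qᵏ q)

      τ : ℕ → Carrier
      τ k = cauchyTerm q k * poch z q k * poch (z * q) q k ⁻¹

      chuVandermonde-1# : ∀ k → k ≤ N → qDiff 1# k (term 1# 0) 0 ≈ τ k
      chuVandermonde-1# k k≤N = trans (qDiff-1#-term k 0 (≡.subst (_≤ N) (≡.sym (ℕ.+-identityʳ k)) k≤N))
        (solve 2 (λ C I → C :* ((:1 :* :1) :* I) := C :* I) refl (cauchyTerm q k * poch z q k) (poch (z * q) q k ⁻¹))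

      chuVandermonde-q : ∀ k → k ≤ N → qDiff q k (term (z * pow q k) 0) 0 ≈ τ k
      chuVandermonde-q k k≤N = begin
        qDiff q k (term (z * pow q k) 0) 0
          ≈⟨ qDiff-q-term (z * pow q k) k 0 k≤N (solve 2 (λ z qᵏ → z :* qᵏ := z :* :1 :* qᵏ) refl z (pow q k)) ⟩
        (cauchyTerm q k * poch (z * 1#) q k) * ((1# * 1#) * poch (z * q) q k ⁻¹)
          ≈⟨ *-cong (*-congˡ (poch-cong k (*-identityʳ z))) (trans (*-congʳ (*-identityˡ 1#)) (*-identityˡ _)) ⟩
        τ k ∎

      τ-difference : ∀ k → k ≤ N → τ k + (- z) * (pow q k * τ k) ≈ (1# - z) * cauchyTerm q k
      τ-difference k k≤N = begin
        τ k + (- z) * (pow q k * τ k)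
          ≈⟨ solve 5 (λ c P z qᵏ I → c :* P :* I :+ (:- z) :* (qᵏ :* (c :* P :* I)) := c :* (P :* (:1 :- z :* qᵏ)) :* I)
                     refl (cauchyTerm q k) (poch z q k) z (pow q k) (poch (z * q) q k ⁻¹) ⟩
        cauchyTerm q k * poch z q (suc k) * poch (z * q) q k ⁻¹
          ≈⟨ *-congʳ (*-congˡ (poch-unfoldˡ z k)) ⟩
        cauchyTerm q k * ((1# - z) * poch (z * q) q k) * poch (z * q) q k ⁻¹
          ≈⟨ solve 4 (λ c a P I → c :* (a :* P) :* I := (a :* c) :* (P :* I))
                     refl (cauchyTerm q k) (1# - z) (poch (z * q) q k) (poch (z * q) q k ⁻¹) ⟩
        ((1# - z) * cauchyTerm q k) * (poch (z * q) q k * poch (z * q) q k ⁻¹)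
          ≈⟨ *-congˡ (⁻¹-inverse _ (Pzq≉0 k k≤N)) ⟩
        ((1# - z) * cauchyTerm q k) * 1#
          ≈⟨ *-identityʳ _ ⟩
        (1# - z) * cauchyTerm q k ∎

      k+t≡N⇒k≤N : ∀ {k t} → k ℕ.+ t ≡ N → k ≤ N
      k+t≡N⇒k≤N {k} {t} k+t≡N = ≡.subst (k ≤_) k+t≡N (ℕ.m≤m+n k t)

      module _ (c : Carrier) where

        leftCoeff : ℕ → Carrier
        leftCoeff n = poch q q n * poch (z * q) q n ⁻¹ * pow (z * c) n * pow q (n ℕ.* n)

        rightCoeff : ℕ → Carrier
        rightCoeff n = poch q q n * poch (z * q) q n ⁻¹ * pow (c * q) n

        leftSide : Carrier
        leftSide = gaussianSum N (λ n r → leftCoeff n * poch ((c * q) * pow q n) q r)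

        rightSide : Carrier
        rightSide = gaussianSum N (λ n r → rightCoeff n * poch (c * q) q r)

        leftSummand : ∀ n j k → n ℕ.+ j ≡ k →
          leftCoeff n * cauchyTerm ((c * q) * pow q n) j ≈ pow c k * (cauchyTerm q j * term (z * pow q k) 0 n)
        leftSummand n j k n+j≡k = begin
          leftCoeff n * cauchyTerm ((c * q) * pow q n) j
            ≈⟨ *-cong (*-congʳ (*-congˡ (pow-distrib-* z c n))) cauchyTerm-expand ⟩
          (Pₙ * I * (zⁿ * cⁿ) * qⁿⁿ) * ((cʲ * qⁿʲ) * cauchyTerm q j)
            ≈⟨ solve 8 (λ Pₙ I zⁿ cⁿ qⁿⁿ cʲ qⁿʲ t → (Pₙ :* I :* (zⁿ :* cⁿ) :* qⁿⁿ) :* ((cʲ :* qⁿʲ) :* t)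
                                                 := (cⁿ :* cʲ) :* ((zⁿ :* (qⁿⁿ :* qⁿʲ)) :* (t :* (Pₙ :* I))))
                       refl Pₙ I zⁿ cⁿ qⁿⁿ cʲ qⁿʲ (cauchyTerm q j) ⟩
          (cⁿ * cʲ) * ((zⁿ * (qⁿⁿ * qⁿʲ)) * (cauchyTerm q j * (Pₙ * I)))
            ≈⟨ *-cong (trans (sym (pow-+ c n j)) (reflexive (≡.cong (pow c) n+j≡k)))
                      (*-congʳ (trans (*-congˡ qⁿⁿqⁿʲ≈[qᵏ]ⁿ) (sym (pow-distrib-* z (pow q k) n)))) ⟩
          pow c k * (pow (z * pow q k) n * (cauchyTerm q j * (Pₙ * I)))
            ≈⟨ *-congˡ (solve 4 (λ w t P I → w :* (t :* (P :* I)) := t :* (w :* P :* I))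
                                refl (pow (z * pow q k) n) (cauchyTerm q j) Pₙ I) ⟩
          pow c k * (cauchyTerm q j * (pow (z * pow q k) n * Pₙ * I))
            ≈⟨ *-congˡ (*-congˡ (*-congˡ (reflexive (≡.cong (λ t → poch (z * q) q t ⁻¹)
                                                            (≡.sym (ℕ.+-identityʳ n)))))) ⟩
          pow c k * (cauchyTerm q j * term (z * pow q k) 0 n) ∎
          where
          Pₙ = poch q q n
          I = poch (z * q) q n ⁻¹
          zⁿ = pow z n
          cⁿ = pow c n
          cʲ = pow c j
          qⁿⁿ = pow q (n ℕ.* n)
          qⁿʲ = pow q (n ℕ.* j)
          cauchyTerm-expand : cauchyTerm ((c * q) * pow q n) j ≈ (cʲ * qⁿʲ) * cauchyTerm q j
          cauchyTerm-expand = begin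
            cauchyTerm ((c * q) * pow q n) j     ≈⟨ cauchyTerm-cong j (xy∙z≈xz∙y c q (pow q n)) ⟩
            cauchyTerm ((c * pow q n) * q) j     ≈⟨ cauchyTerm-* (c * pow q n) q j ⟩
            pow (c * pow q n) j * cauchyTerm q j ≈⟨ *-congʳ (trans (pow-distrib-* c (pow q n) j) (*-congˡ (pow-pow q n j))) ⟩
            (cʲ * qⁿʲ) * cauchyTerm q j          ∎
          qⁿⁿqⁿʲ≈[qᵏ]ⁿ : qⁿⁿ * qⁿʲ ≈ pow (pow q k) n
          qⁿⁿqⁿʲ≈[qᵏ]ⁿ = begin
            qⁿⁿ * qⁿʲ                ≈⟨ pow-+ q (n ℕ.* n) (n ℕ.* j) ⟨
            pow q (n ℕ.* n ℕ.+ n ℕ.* j) ≡⟨ ≡.cong (pow q) (ℕ.*-distribˡ-+ n n j) ⟨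
            pow q (n ℕ.* (n ℕ.+ j))     ≡⟨ ≡.cong (λ i → pow q (n ℕ.* i)) n+j≡k ⟩
            pow q (n ℕ.* k)             ≡⟨ ≡.cong (pow q) (ℕ.*-comm n k) ⟩
            pow q (k ℕ.* n)          ≈⟨ pow-pow q k n ⟨
            pow (pow q k) n          ∎

        rightSummand : ∀ n j k → n ℕ.+ j ≡ k →
          rightCoeff n * cauchyTerm (c * q) j ≈ (pow c k * pow q k) * (cauchyTerm 1# j * term 1# 0 n)
        rightSummand n j k n+j≡k = begin
          (Pₙ * I * cqⁿ) * cauchyTerm (c * q) j
            ≈⟨ *-congˡ (trans (cauchyTerm-cong j (sym (*-identityʳ _))) (cauchyTerm-* (c * q) 1# j)) ⟩
          (Pₙ * I * cqⁿ) * (cqʲ * cauchyTerm 1# j)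
            ≈⟨ solve 5 (λ Pₙ I a b t → (Pₙ :* I :* a) :* (b :* t) := (a :* b) :* (t :* (:1 :* Pₙ :* I)))
                       refl Pₙ I (cqⁿ) (cqʲ) (cauchyTerm 1# j) ⟩
          (cqⁿ * cqʲ) * (cauchyTerm 1# j * (1# * Pₙ * I))
            ≈⟨ *-cong (trans (sym (pow-+ (c * q) n j)) (trans (reflexive (≡.cong (pow (c * q)) n+j≡k)) (pow-distrib-* c q k)))
                      (*-congˡ (*-cong (*-congʳ (sym (pow-1# n)))
                                       (reflexive (≡.cong (λ t → poch (z * q) q t ⁻¹) (≡.sym (ℕ.+-identityʳ n)))))) ⟩
          (pow c k * pow q k) * (cauchyTerm 1# j * term 1# 0 n) ∎
          where
          Pₙ = poch q q n
          I = poch (z * q) q n ⁻¹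
          cqⁿ = pow (c * q) n
          cqʲ = pow (c * q) j

        leftSide-expansion : leftSide ≈ gaussianSum N (λ k _ → pow c k * τ k)
        leftSide-expansion = begin
          leftSide
            ≈⟨ gaussianSum-cong N (λ n r _ → *-congˡ (q-binomial-theorem r _)) ⟩
          gaussianSum N (λ n r → leftCoeff n * gaussianSum r (λ j _ → cauchyTerm ((c * q) * pow q n) j))
            ≈⟨ gaussianSum-nested N leftCoeff (λ n j _ → cauchyTerm ((c * q) * pow q n) j) ⟩
          gaussianSum N (λ k _ → gaussianSum k (λ n j → leftCoeff n * cauchyTerm ((c * q) * pow q n) j))
            ≈⟨ gaussianSum-cong N (λ k t k+t≡N → begin
                 gaussianSum k (λ n j → leftCoeff n * cauchyTerm ((c * q) * pow q n) j)
                   ≈⟨ gaussianSum-cong k (λ n j n+j≡k → leftSummand n j k n+j≡k) ⟩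
                 gaussianSum k (λ n j → pow c k * (cauchyTerm q j * term (z * pow q k) 0 n))
                   ≈⟨ *-distribˡ-gaussianSum k (pow c k) _ ⟨
                 pow c k * qDiff q k (term (z * pow q k) 0) 0
                   ≈⟨ *-congˡ (chuVandermonde-q k (k+t≡N⇒k≤N k+t≡N)) ⟩
                 pow c k * τ k ∎) ⟩
          gaussianSum N (λ k _ → pow c k * τ k) ∎

        rightSide-expansion : rightSide ≈ gaussianSum N (λ k _ → pow c k * (pow q k * τ k))
        rightSide-expansion = begin
          rightSide
            ≈⟨ gaussianSum-cong N (λ n r _ → *-congˡ (q-binomial-theorem r _)) ⟩
          gaussianSum N (λ n r → rightCoeff n * gaussianSum r (λ j _ → cauchyTerm (c * q) j))
            ≈⟨ gaussianSum-nested N rightCoeff (λ n j _ → cauchyTerm (c * q) j) ⟩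
          gaussianSum N (λ k _ → gaussianSum k (λ n j → rightCoeff n * cauchyTerm (c * q) j))
            ≈⟨ gaussianSum-cong N (λ k t k+t≡N → begin
                 gaussianSum k (λ n j → rightCoeff n * cauchyTerm (c * q) j)
                   ≈⟨ gaussianSum-cong k (λ n j n+j≡k → rightSummand n j k n+j≡k) ⟩
                 gaussianSum k (λ n j → (pow c k * pow q k) * (cauchyTerm 1# j * term 1# 0 n))
                   ≈⟨ *-distribˡ-gaussianSum k (pow c k * pow q k) _ ⟨
                 (pow c k * pow q k) * qDiff 1# k (term 1# 0) 0
                   ≈⟨ *-congˡ (chuVandermonde-1# k (k+t≡N⇒k≤N k+t≡N)) ⟩
                 (pow c k * pow q k) * τ k
                   ≈⟨ *-assoc _ _ _ ⟩
                 pow c k * (pow q k * τ k) ∎) ⟩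
          gaussianSum N (λ k _ → pow c k * (pow q k * τ k)) ∎

        leftSide-rightSide : leftSide + (- z) * rightSide ≈ (1# - z) * poch (c * q) q N
        leftSide-rightSide = begin
          leftSide + (- z) * rightSide
            ≈⟨ +-cong leftSide-expansion (*-congˡ rightSide-expansion) ⟩
          gaussianSum N (λ k _ → pow c k * τ k) + (- z) * gaussianSum N (λ k _ → pow c k * (pow q k * τ k))
            ≈⟨ +-congˡ (*-distribˡ-gaussianSum N (- z) _) ⟩
          gaussianSum N (λ k _ → pow c k * τ k) + gaussianSum N (λ k _ → (- z) * (pow c k * (pow q k * τ k)))
            ≈⟨ gaussianSum-+ N _ _ ⟨
          gaussianSum N (λ k _ → pow c k * τ k + (- z) * (pow c k * (pow q k * τ k)))
            ≈⟨ gaussianSum-cong N (λ k t k+t≡N → coefficient k (k+t≡N⇒k≤N k+t≡N)) ⟩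
          gaussianSum N (λ k _ → (1# - z) * cauchyTerm (c * q) k)
            ≈⟨ *-distribˡ-gaussianSum N (1# - z) _ ⟨
          (1# - z) * gaussianSum N (λ k _ → cauchyTerm (c * q) k)
            ≈⟨ *-congˡ (q-binomial-theorem N (c * q)) ⟨
          (1# - z) * poch (c * q) q N ∎
          where
          coefficient : ∀ k → k ≤ N →
                        pow c k * τ k + (- z) * (pow c k * (pow q k * τ k)) ≈ (1# - z) * cauchyTerm (c * q) k
          coefficient k k≤N = begin
            pow c k * τ k + (- z) * (pow c k * (pow q k * τ k))
              ≈⟨ solve 4 (λ cᵏ τ z qᵏ → cᵏ :* τ :+ (:- z) :* (cᵏ :* (qᵏ :* τ)) := cᵏ :* (τ :+ (:- z) :* (qᵏ :* τ)))
                         refl (pow c k) (τ k) z (pow q k) ⟩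
            pow c k * (τ k + (- z) * (pow q k * τ k))
              ≈⟨ *-congˡ (τ-difference k k≤N) ⟩
            pow c k * ((1# - z) * cauchyTerm q k)
              ≈⟨ x∙yz≈y∙xz (pow c k) (1# - z) (cauchyTerm q k) ⟩
            (1# - z) * (pow c k * cauchyTerm q k)
              ≈⟨ *-congˡ (cauchyTerm-* c q k) ⟨
            (1# - z) * cauchyTerm (c * q) k ∎

        module _ (Pq≉0 : ∀ k → k ≤ N → poch q q k ≉ 0#) (Pcq≉0 : ∀ n → n ≤ N → poch (c * q) q n ≉ 0#) where

          sum0≈P+P*sum1 : ∀ (f h : ℕ → Carrier) → h 0 ≈ poch (c * q) q N →
                          (∀ n → n ≤ N → poch (c * q) q N * f n ≈ h n) →
                          sum0 N h ≈ poch (c * q) q N + poch (c * q) q N * sum1 N f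
          sum0≈P+P*sum1 f h h0≈P Pf≈h = +-cong h0≈P (sym (trans (*-distribˡ-sum1 N _ f) (sum1-cong N Pf≈h)))

          leftSide≈P+P*sum1 : leftSide ≈ poch (c * q) q N + poch (c * q) q N *
                        sum1 N (λ n → qbinom q N n * (poch q q n * pow (z * c) n * pow q (n ℕ.* n))
                                       / (poch (z * q) q n * poch (c * q) q n))
          leftSide≈P+P*sum1 = trans (gaussianSum≈sum0 N _) (sum0≈P+P*sum1 _ _ firstTerm clear)
            where
            firstTerm : qbinomRec N 0 * (leftCoeff 0 * poch ((c * q) * 1#) q (N ∸ 0)) ≈ poch (c * q) q N
            firstTerm = begin
              qbinomRec N 0 * (((1# * 1# ⁻¹) * 1# * 1#) * poch ((c * q) * 1#) q N)
                ≈⟨ *-cong (qbinomRec-0 N) (*-cong (solve 1 (λ i → :1 :* i :* :1 :* :1 := i) refl (1# ⁻¹)) (poch-cong N (*-identityʳ _))) ⟩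
              1# * (1# ⁻¹ * poch (c * q) q N)
                ≈⟨ trans (*-identityˡ _) (trans (*-congʳ 1⁻¹≈1) (*-identityˡ _)) ⟩
              poch (c * q) q N ∎
            clear : ∀ n → n ≤ N → poch (c * q) q N * (qbinom q N n * (poch q q n * pow (z * c) n * pow q (n ℕ.* n))
                                                       / (poch (z * q) q n * poch (c * q) q n))
                                  ≈ qbinomRec N n * (leftCoeff n * poch ((c * q) * pow q n) q (N ∸ n))
            clear n n≤N = begin
              P * ((qbinom q N n * X) * (poch (z * q) q n * Pcₙ) ⁻¹)
                ≈⟨ *-cong (trans (reflexive (≡.cong (poch (c * q) q) (≡.sym (ℕ.m+[n∸m]≡n n≤N)))) (poch-+ (c * q) n (N ∸ n)))
                          (*-cong (*-congʳ (qbinom≈qbinomRec N n n≤N Pq≉0)) (⁻¹-distrib-* (Pzq≉0 n n≤N) (Pcq≉0 n n≤N))) ⟩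
              (Pcₙ * R) * ((qbinomRec N n * X) * (poch (z * q) q n ⁻¹ * Pcₙ ⁻¹))
                ≈⟨ solve 8 (λ Pcₙ R B Pₙ zcⁿ qⁿⁿ I Iₙ → (Pcₙ :* R) :* ((B :* (Pₙ :* zcⁿ :* qⁿⁿ)) :* (I :* Iₙ))
                                                     := (Pcₙ :* Iₙ) :* (B :* ((Pₙ :* I :* zcⁿ :* qⁿⁿ) :* R)))
                           refl Pcₙ R (qbinomRec N n) (poch q q n) (pow (z * c) n) (pow q (n ℕ.* n))
                                (poch (z * q) q n ⁻¹) (Pcₙ ⁻¹) ⟩
              (Pcₙ * Pcₙ ⁻¹) * (qbinomRec N n * (leftCoeff n * R))
                ≈⟨ trans (*-congʳ (⁻¹-inverse Pcₙ (Pcq≉0 n n≤N))) (*-identityˡ _) ⟩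
              qbinomRec N n * (leftCoeff n * R) ∎
              where
              P = poch (c * q) q N
              Pcₙ = poch (c * q) q n
              X = poch q q n * pow (z * c) n * pow q (n ℕ.* n)
              R = poch ((c * q) * pow q n) q (N ∸ n)

          rightSide≈P+P*sum1 : rightSide ≈ poch (c * q) q N + poch (c * q) q N *
                         sum1 N (λ n → qbinom q N n * (poch q q n * poch (c * q) q (N ∸ n) * pow (c * q) n)
                                        / (poch (z * q) q n * poch (c * q) q N))
          rightSide≈P+P*sum1 = trans (gaussianSum≈sum0 N _) (sum0≈P+P*sum1 _ _ firstTerm clear)
            where
            firstTerm : qbinomRec N 0 * (rightCoeff 0 * poch (c * q) q (N ∸ 0)) ≈ poch (c * q) q N
            firstTerm = begin
              qbinomRec N 0 * (((1# * 1# ⁻¹) * 1#) * poch (c * q) q N)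
                ≈⟨ *-cong (qbinomRec-0 N) (*-congʳ (solve 1 (λ i → :1 :* i :* :1 := i) refl (1# ⁻¹))) ⟩
              1# * (1# ⁻¹ * poch (c * q) q N)
                ≈⟨ trans (*-identityˡ _) (trans (*-congʳ 1⁻¹≈1) (*-identityˡ _)) ⟩
              poch (c * q) q N ∎
            clear : ∀ n → n ≤ N → poch (c * q) q N * (qbinom q N n * (poch q q n * poch (c * q) q (N ∸ n) * pow (c * q) n)
                                                       / (poch (z * q) q n * poch (c * q) q N))
                                  ≈ qbinomRec N n * (rightCoeff n * poch (c * q) q (N ∸ n))
            clear n n≤N = begin
              P * ((qbinom q N n * X) * (poch (z * q) q n * P) ⁻¹)
                ≈⟨ *-congˡ (*-cong (*-congʳ (qbinom≈qbinomRec N n n≤N Pq≉0)) (⁻¹-distrib-* (Pzq≉0 n n≤N) (Pcq≉0 N ℕ.≤-refl))) ⟩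
              P * ((qbinomRec N n * X) * (poch (z * q) q n ⁻¹ * P ⁻¹))
                ≈⟨ solve 7 (λ P B Pₙ R cqⁿ I I′ → P :* ((B :* (Pₙ :* R :* cqⁿ)) :* (I :* I′))
                                                := (P :* I′) :* (B :* ((Pₙ :* I :* cqⁿ) :* R)))
                           refl P (qbinomRec N n) (poch q q n) (poch (c * q) q (N ∸ n)) (pow (c * q) n)
                                (poch (z * q) q n ⁻¹) (P ⁻¹) ⟩
              (P * P ⁻¹) * (qbinomRec N n * (rightCoeff n * poch (c * q) q (N ∸ n)))
                ≈⟨ trans (*-congʳ (⁻¹-inverse P (Pcq≉0 N ℕ.≤-refl))) (*-identityˡ _) ⟩
              qbinomRec N n * (rightCoeff n * poch (c * q) q (N ∸ n)) ∎
              where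
              P = poch (c * q) q N
              X = poch q q n * poch (c * q) q (N ∸ n) * pow (c * q) n

-- Imported only here: inside QSeries it would clash with the field's _*_.
open import Data.Nat using (_*_)

corollary2p3 : {a ℓ : Level} (F : Field a ℓ) →
  let open Field F renaming (_*_ to _·_) in
  let open FieldOps F in
  (q z c : Carrier) (N : ℕ) →
  (∀ k → k ≤ N → ¬ (poch q q k ≈ 0#)) →
  (∀ n → n ≤ N → ¬ (poch (z · q) q n ≈ 0#)) →
  (∀ n → n ≤ N → ¬ (poch (c · q) q n ≈ 0#)) →
  sum1 N (λ n → qbinom q N n · (poch q q n · pow (z · c) n · pow q (n * n))
                  / (poch (z · q) q n · poch (c · q) q n))
    ≈ z · sum1 N (λ n → qbinom q N n · (poch q q n · poch (c · q) q (N ∸ n) · pow (c · q) n)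
                  / (poch (z · q) q n · poch (c · q) q N))
corollary2p3 F q z c N Pq≉0 Pzq≉0 Pcq≉0 =
  *-cancelˡ (Pcq≉0 N ℕ.≤-refl)
    (P*s≈P*zs′ z (leftSide≈P+P*sum1 q z N Pzq≉0 c Pq≉0 Pcq≉0) (rightSide≈P+P*sum1 q z N Pzq≉0 c Pq≉0 Pcq≉0)
                 (leftSide-rightSide q z N Pzq≉0 c))
  where open QSeries F
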